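{- Let $P$ and $Q$ be natural posets and $\mathcal{I}$ an open down-set in $\mathrm{Pro}(P,Q)$. (a) $\mathcal{I}$ is also closed if and only if for every increasing sequence $f_1\le f_2\le\cdots$ of elements of $\mathcal{I}$, the colimit $f$ given by $f(p)=\bigcup_i f_i(p)$ lies in $\mathcal{I}$. (b) $\mathcal{I}$ is regular if and only if for every increasing sequence $f_1\le f_2\le\cdots$ of elements of $\mathcal{I}$ whose colimit $f$ is large, $f$ lies in $\mathcal{I}$. Analogous statements hold for open up-sets $\mathcal{F}$ with decreasing sequences of elements of $\mathcal{F}$ and their limits (pointwise intersections), with "large" replaced by "small" in (b).
   Context: A poset is natural if every antichain is finite, every descending chain stabilizes, and for every $p$ the set $\{p'\,:\,p'\le p\}$ is finite. $\widehat{Q}$ is the set of down-sets of $Q$ ordered by inclusion. A profunctor $f:P\to Q$ is an order-preserving map $f:P\to\widehat{Q}$; $\mathrm{Pro}(P,Q)$ is ordered pointwise by inclusion. $f$ is large if $\{p: f(p)\neq Q\}$ is finite and small if $\bigcup_p f(p)$ is finite. The topology on $\mathrm{Pro}(P,Q)$ has as basis the sets $U(g,h)=\{f: g\le f\le h\}$ with $g$ small, $h$ large. An open set is regular if it is the interior of its closure. -}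

module Defs where

open import Level using (Level; 0ℓ) renaming (suc to lsuc)
open import Data.Nat using (ℕ; suc) renaming (_≤_ to _≤ℕ_)
open import Data.Product using (Σ; ∃; _×_; _,_)
open import Data.List using (List)
open import Data.List.Relation.Unary.Any using (Any)
open import Relation.Nullary using (¬_)
open import Relation.Binary.Bundles using (Poset)

Poset₀ : Set₁
Poset₀ = Poset 0ℓ 0ℓ 0ℓ

module _ (P : Poset₀) where
  open Poset P

  Finite : (Carrier → Set) → Set
  Finite S = Σ (List Carrier) λ xs → ∀ x → S x → Any (x ≈_) xs

  IsAntichain : (Carrier → Set) → Set
  IsAntichain A = ∀ x y → A x → A y → x ≤ y → x ≈ y

  record IsNatural : Set₁ where
    field
      antichains-finite : ∀ (A : Carrier → Set) → IsAntichain A → Finite A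
      descending-stabilizes : ∀ (c : ℕ → Carrier) → (∀ n → c (suc n) ≤ c n) →
                              ∃ λ N → ∀ n → N ≤ℕ n → c n ≈ c N
      principal-finite : ∀ p → Finite (λ p' → p' ≤ p)

-- A profunctor f : P → Q, i.e. an order-preserving map P → Q̂ (down-sets of Q,
-- ordered by inclusion). A down-set of Q is a predicate closed downwards.
record Pro (P Q : Poset₀) : Set₁ where
  private
    module P = Poset P
    module Q = Poset Q
  field
    app  : P.Carrier → Q.Carrier → Set
    down : ∀ {p q q'} → q' Q.≤ q → app p q → app p q'
    mono : ∀ {p p' q} → p P.≤ p' → app p q → app p' q
open Pro public

module _ {P Q : Poset₀} where
  private
    module P = Poset P
    module Q = Poset Q

  _⊑_ : Pro P Q → Pro P Q → Set
  f ⊑ g = ∀ p q → app f p q → app g p q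

  Large : Pro P Q → Set
  Large f = Finite P (λ p → ¬ (∀ q → app f p q))

  Small : Pro P Q → Set
  Small f = Finite Q (λ q → ∃ λ p → app f p q)

  PSet : Set₂
  PSet = Pro P Q → Set₁

  U : Pro P Q → Pro P Q → Pro P Q → Set
  U g h f = g ⊑ f × f ⊑ h

  Interior : PSet → PSet
  Interior 𝒰 f = Σ (Pro P Q) λ g → Σ (Pro P Q) λ h →
    Small g × Large h × U g h f × (∀ f' → U g h f' → 𝒰 f')

  IsOpen : PSet → Set₁
  IsOpen 𝒰 = ∀ f → 𝒰 f → Interior 𝒰 f

  Closure : PSet → PSet
  Closure 𝒰 f = ∀ g h → Small g → Large h → U g h f →
    Σ (Pro P Q) λ f' → U g h f' × 𝒰 f'

  IsClosed : PSet → Set₁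
  IsClosed 𝒰 = IsOpen (λ f → ¬ 𝒰 f)

  IsRegular : PSet → Set₁
  IsRegular 𝒰 = (∀ f → Interior (Closure 𝒰) f → 𝒰 f) × (∀ f → 𝒰 f → Interior (Closure 𝒰) f)

  IsDownSet : PSet → Set₁
  IsDownSet 𝒰 = ∀ f g → f ⊑ g → 𝒰 g → 𝒰 f

  IsUpSet : PSet → Set₁
  IsUpSet 𝒰 = ∀ f g → f ⊑ g → 𝒰 f → 𝒰 g

  Increasing : (ℕ → Pro P Q) → Set
  Increasing fs = ∀ n → fs n ⊑ fs (suc n)

  Decreasing : (ℕ → Pro P Q) → Set
  Decreasing fs = ∀ n → fs (suc n) ⊑ fs n

  colim : (ℕ → Pro P Q) → Pro P Q
  colim fs = record
    { app  = λ p q → ∃ λ i → app (fs i) p q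
    ; down = λ { q'≤q (i , x) → i , down (fs i) q'≤q x }
    ; mono = λ { p≤p' (i , x) → i , mono (fs i) p≤p' x } }

  lim : (ℕ → Pro P Q) → Pro P Q
  lim fs = record
    { app  = λ p q → ∀ i → app (fs i) p q
    ; down = λ q'≤q x i → down (fs i) q'≤q (x i)
    ; mono = λ p≤p' x i → mono (fs i) p≤p' (x i) }

{-# OPTIONS --safe #-}
-- A natural poset is exhausted by an increasing sequence of finite down-sets (its layers: each
-- adds the down-closure of the minimal elements not yet covered), and every up-set is generated
-- by its finitely many minimal elements. Hence a small profunctor below the colimit of an
-- increasing sequence already lies below one of its terms, and dually a large one above a limit
-- of a decreasing sequence lies above one of its terms. Every f is the colimit of its small
-- truncations to the layers of Q and the limit of its large cotruncations away from the layers
-- of P. For a down-set 𝓘, f lies in the closure of 𝓘 iff all small g ⊑ f lie in 𝓘, so these two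
-- facts turn "𝓘 contains its closure" into closure under colimits; for (b), U(⊥, colim fs) is a
-- basic neighbourhood inside the closure when colim fs is large, and a point of the interior of
-- the closure lies below the large upper bound of its neighbourhood, which is in the closure.
module Submission where

open import Defs
open import Level using (0ℓ) renaming (suc to lsuc)
open import Data.Product using (_×_)
open import Function.Bundles using (_⇔_)
open import Axiom.ExcludedMiddle using (ExcludedMiddle)

open import Axiom.DoubleNegationElimination using (em⇒dne)
open import Data.Empty using (⊥; ⊥-elim)
open import Data.Unit using (⊤; tt)
open import Data.Product using (Σ; ∃; _,_; proj₁; proj₂)
open import Data.Sum using (_⊎_; inj₁; inj₂; [_,_])
open import Data.Nat using (ℕ; zero; suc; _⊔_; _≤′_; ≤′-refl; ≤′-step) renaming (_≤_ to _≤ℕ_)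
open import Data.Nat.Properties using (m≤m⊔n; m≤n⊔m; ≤⇒≤′; n≤1+n)
open import Data.List using (List; []; _∷_; _++_)
open import Data.List.Relation.Unary.Any using (Any; here; there)
import Data.List.Relation.Unary.Any as Any
open import Data.List.Relation.Unary.All as All using (All; []; _∷_)
open import Data.List.Relation.Unary.Any.Properties using (++⁺ˡ; ++⁺ʳ)
open import Function.Bundles using (mk⇔)
open import Function.Construct.Composition using (_⇔-∘_)
open import Induction.WellFounded using (WellFounded; Acc; acc)
import Induction.WellFounded as WF
open import Relation.Binary.Bundles using (Poset)
open import Relation.Binary.Definitions using (_Respects_)
open import Relation.Nullary using (¬_; yes; no)
import Relation.Binary.Properties.Poset as PosetProperties

Ascending : {A : Set} → (ℕ → A → Set) → Set
Ascending T = ∀ {m n} → m ≤ℕ n → ∀ {x} → T m x → T n x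

ascending : {A : Set} {T : ℕ → A → Set} → (∀ n {x} → T n x → T (suc n) x) → Ascending T
ascending {T = T} step m≤n = go (≤⇒≤′ m≤n)
  where
    go : ∀ {m n} → m ≤′ n → ∀ {x} → T m x → T n x
    go ≤′-refl t = t
    go (≤′-step {n = n} m≤′n) t = step n (go m≤′n t)

eventually-all : {A : Set} {T : ℕ → A → Set} → Ascending T →
  ∀ {xs} → All (λ x → ∃ λ n → T n x) xs → ∃ λ n → All (T n) xs
eventually-all asc [] = 0 , []
eventually-all asc ((n₁ , t) ∷ ts) with eventually-all asc ts
... | n₂ , ts′ = n₁ ⊔ n₂ , asc (m≤m⊔n n₁ n₂) t ∷ All.map (asc (m≤n⊔m n₁ n₂)) ts′

module FiniteSets (em : ExcludedMiddle 0ℓ) (X : Poset₀) where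
  open Poset X
  open PosetProperties X using (_<_)

  dne : {A : Set} → ¬ ¬ A → A
  dne = em⇒dne em

  finite-eventually : {S : Carrier → Set} → Finite X S → {T : ℕ → Carrier → Set} →
    Ascending T → (∀ {n} → T n Respects _≈_) →
    (∀ x → S x → ∃ λ n → T n x) → ∃ λ n → ∀ x → S x → T n x
  finite-eventually {S} (xs , cover) {T} asc resp ev
    with eventually-all (λ m≤n t′ s → asc m≤n (t′ s)) (All.tabulate (λ {y} _ → ev′ y))
    where
      -- a listed element y inherits a witness only when it represents some member of S
      T′ : ℕ → Carrier → Set
      T′ n y = (∃ λ x → S x × x ≈ y) → T n y
      ev′ : ∀ y → ∃ λ n → T′ n y
      ev′ y with em {∃ λ x → S x × x ≈ y}
      ... | yes (x , sx , x≈y) = proj₁ (ev x sx) , λ _ → resp x≈y (proj₂ (ev x sx))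
      ... | no none = 0 , λ some → ⊥-elim (none some)
  ... | n , onList = n , λ x sx →
    let (t′ , x≈y) = All.lookupAny onList (cover x sx) in resp (Eq.sym x≈y) (t′ (x , sx , x≈y))

  Minimal : (Carrier → Set) → Carrier → Set
  Minimal S m = S m × (∀ y → y ≤ m → S y → y ≈ m)

  minimal-antichain : (S : Carrier → Set) → IsAntichain X (Minimal S)
  minimal-antichain S x y (sx , _) (_ , least) x≤y = least x x≤y sx

  minimal-if-nothing-below : {S : Carrier → Set} {x : Carrier} →
    S x → (∀ y → y < x → ¬ S y) → Minimal S x
  minimal-if-nothing-below sx none = sx , λ y y≤x sy → dne λ y≉x → none y (y≤x , y≉x) sy

  DownClosure : (Carrier → Set) → Carrier → Set
  DownClosure S x = ∃ λ m → S m × x ≤ m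

  finite-∪ : {S T : Carrier → Set} → Finite X S → Finite X T → Finite X (λ x → S x ⊎ T x)
  finite-∪ (xs , coverS) (ys , coverT) =
    xs ++ ys , λ x → [ (λ s → ++⁺ˡ (coverS x s)) , (λ t → ++⁺ʳ xs (coverT x t)) ]

  finite-⊆ : {S T : Carrier → Set} → (∀ x → S x → T x) → Finite X T → Finite X S
  finite-⊆ S⊆T (xs , cover) = xs , λ x s → cover x (S⊆T x s)

  module Natural (natural : IsNatural X) where
    open IsNatural natural

    <-wellFounded : WellFounded _<_
    <-wellFounded x₀ = dne λ ¬acc → no-infinite-descent (x₀ , ¬acc)
      where
        Inaccessible : Set
        Inaccessible = Σ Carrier λ x → ¬ Acc _<_ x

        smaller : (x : Inaccessible) → Σ Inaccessible λ y → proj₁ y < proj₁ x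
        smaller (x , ¬acc) = dne λ none → ¬acc (acc λ {y} y<x → dne λ ¬accy → none ((y , ¬accy) , y<x))

        descent : Inaccessible → ℕ → Inaccessible
        descent x zero = x
        descent x (suc n) = proj₁ (smaller (descent x n))

        no-infinite-descent : Inaccessible → ⊥
        no-infinite-descent x with descending-stabilizes (λ n → proj₁ (descent x n))
                                                         (λ n → proj₁ (proj₂ (smaller (descent x n))))
        ... | N , stable = proj₂ (proj₂ (smaller (descent x N))) (stable (suc N) (n≤1+n N))

    open WF.All <-wellFounded 0ℓ using (wfRec)

    minimal-below : {S : Carrier → Set} → ∀ x → S x → ∃ λ m → Minimal S m × m ≤ x
    minimal-below {S} = wfRec _ step
      where
        step : ∀ x → (∀ {y} → y < x → S y → ∃ λ m → Minimal S m × m ≤ y) →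
          S x → ∃ λ m → Minimal S m × m ≤ x
        step x ih sx with em {∃ λ y → y < x × S y}
        ... | yes (y , y<x , sy) with ih y<x sy
        ...   | m , minimal , m≤y = m , minimal , trans m≤y (proj₁ y<x)
        step x ih sx | no nothing-below =
          x , minimal-if-nothing-below sx (λ y y<x sy → nothing-below (y , y<x , sy)) , refl

    minimal-finite : (S : Carrier → Set) → Finite X (Minimal S)
    minimal-finite S = antichains-finite (Minimal S) (minimal-antichain S)

    upset-eventually : {S : Carrier → Set} → S Respects _≤_ → {T : ℕ → Carrier → Set} →
      Ascending T → (∀ {n} → T n Respects _≤_) →
      (∀ x → S x → ∃ λ n → T n x) → ∃ λ n → ∀ x → S x → T n x
    upset-eventually {S} upS asc upT ev
      with finite-eventually (minimal-finite S) asc (λ x≈y → upT (reflexive x≈y))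
                             (λ m minimal → ev m (proj₁ minimal))
    ... | n , onMinimal = n , λ x sx →
      let (m , minimal , m≤x) = minimal-below x sx in upT m≤x (onMinimal m minimal)

    down-closure-finite : {S : Carrier → Set} → Finite X S → Finite X (DownClosure S)
    down-closure-finite {S} (ms , cover) = below ms , λ x (m , sm , x≤m) →
      below-covers ms x (Any.map (λ m≈m′ → trans x≤m (reflexive m≈m′)) (cover m sm))
      where
        below : List Carrier → List Carrier
        below [] = []
        below (m ∷ ms) = proj₁ (principal-finite m) ++ below ms

        below-covers : ∀ ms x → Any (x ≤_) ms → Any (x ≈_) (below ms)
        below-covers (m ∷ ms) x (here x≤m) = ++⁺ˡ (proj₂ (principal-finite m) x x≤m)
        below-covers (m ∷ ms) x (there x≤ms) = ++⁺ʳ (proj₁ (principal-finite m)) (below-covers ms x x≤ms)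

    layer : ℕ → Carrier → Set
    layer zero _ = ⊥
    layer (suc n) x = layer n x ⊎ DownClosure (Minimal (λ y → ¬ layer n y)) x

    layer-ascending : Ascending layer
    layer-ascending = ascending (λ n → inj₁)

    layer-down-closed : ∀ n → layer n Respects _≥_
    layer-down-closed (suc n) y≤x (inj₁ l) = inj₁ (layer-down-closed n y≤x l)
    layer-down-closed (suc n) y≤x (inj₂ (m , minimal , x≤m)) = inj₂ (m , minimal , trans y≤x x≤m)

    layer-finite : ∀ n → Finite X (layer n)
    layer-finite zero = [] , λ _ ()
    layer-finite (suc n) = finite-∪ (layer-finite n) (down-closure-finite (minimal-finite _))

    layer-exhaustive : ∀ x → ∃ λ n → layer n x
    layer-exhaustive = wfRec _ step
      where
        step : ∀ x → (∀ {y} → y < x → ∃ λ n → layer n y) → ∃ λ n → layer n x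
        step x ih with finite-eventually (finite-⊆ (λ _ → proj₁) (principal-finite x)) layer-ascending
                         (λ x≈y → layer-down-closed _ (reflexive (Eq.sym x≈y))) (λ y y<x → ih y<x)
        ... | n , below with em {layer n x}
        ...   | yes l = n , l
        ...   | no ¬l =
          suc n , inj₂ (x , minimal-if-nothing-below ¬l (λ y y<x ¬ly → ¬ly (below y y<x)) , refl)

module Profunctors {P Q : Poset₀} where
  ⊤ᵖ : Pro P Q
  app ⊤ᵖ _ _ = ⊤
  down ⊤ᵖ _ _ = tt
  mono ⊤ᵖ _ _ = tt

  ⊥ᵖ : Pro P Q
  app ⊥ᵖ _ _ = ⊥
  down ⊥ᵖ _ ()
  mono ⊥ᵖ _ ()

  _⊓ᵖ_ : Pro P Q → Pro P Q → Pro P Q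
  app (f ⊓ᵖ g) p q = app f p q × app g p q
  down (f ⊓ᵖ g) q′≤q (a , b) = down f q′≤q a , down g q′≤q b
  mono (f ⊓ᵖ g) p≤p′ (a , b) = mono f p≤p′ a , mono g p≤p′ b

  _⊔ᵖ_ : Pro P Q → Pro P Q → Pro P Q
  app (f ⊔ᵖ g) p q = app f p q ⊎ app g p q
  down (f ⊔ᵖ g) q′≤q = [ (λ a → inj₁ (down f q′≤q a)) , (λ b → inj₂ (down g q′≤q b)) ]
  mono (f ⊔ᵖ g) p≤p′ = [ (λ a → inj₁ (mono f p≤p′ a)) , (λ b → inj₂ (mono g p≤p′ b)) ]

  ⊤ᵖ-large : Large ⊤ᵖ
  ⊤ᵖ-large = [] , λ p ¬full → ⊥-elim (¬full (λ _ → tt))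

  ⊥ᵖ-small : Small ⊥ᵖ
  ⊥ᵖ-small = [] , λ { q (p , ()) }

  large-mono : (f g : Pro P Q) → f ⊑ g → Large f → Large g
  large-mono f g f⊑g (ps , cover) =
    ps , λ p ¬fullg → cover p (λ fullf → ¬fullg (λ q → f⊑g p q (fullf q)))

  small-antimono : (f g : Pro P Q) → f ⊑ g → Small g → Small f
  small-antimono f g f⊑g (qs , cover) = qs , λ { q (p , a) → cover q (p , f⊑g p q a) }

module Topology (em₁ : ExcludedMiddle (lsuc 0ℓ)) {P Q : Poset₀} where
  open Profunctors {P} {Q}

  dne₁ : {A : Set₁} → ¬ ¬ A → A
  dne₁ = em⇒dne em₁

  closed⇔closure⊆ : (𝓢 : PSet {P} {Q}) → IsClosed 𝓢 ⇔ (∀ f → Closure 𝓢 f → 𝓢 f)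
  closed⇔closure⊆ 𝓢 = mk⇔ closure⊆ closed
    where
      closure⊆ : IsClosed 𝓢 → ∀ f → Closure 𝓢 f → 𝓢 f
      closure⊆ isClosed f cl = dne₁ λ ¬s →
        let (g , h , small , large , u , disjoint) = isClosed f ¬s
            (f′ , u′ , s′) = cl g h small large u
        in disjoint f′ u′ s′

      closed : (∀ f → Closure 𝓢 f → 𝓢 f) → IsClosed 𝓢
      closed closure⊆ f ¬s = dne₁ λ ¬interior → ¬s (closure⊆ f λ g h small large u →
        dne₁ λ ¬meets → ¬interior (g , h , small , large , u , λ f′ u′ s′ → ¬meets (f′ , u′ , s′)))

  regular⇔interior-closure⊆ : (𝓢 : PSet {P} {Q}) → IsOpen 𝓢 →
    IsRegular 𝓢 ⇔ (∀ f → Interior (Closure 𝓢) f → 𝓢 f)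
  regular⇔interior-closure⊆ 𝓢 isOpen = mk⇔ proj₁ (λ ⊆𝓢 → ⊆𝓢 , ⊆interior-closure)
    where
      ⊆interior-closure : ∀ f → 𝓢 f → Interior (Closure 𝓢) f
      ⊆interior-closure f s =
        let (g , h , small , large , u , inside) = isOpen f s
        in g , h , small , large , u , λ f′ u′ _ _ _ _ u″ → f′ , u″ , inside f′ u′

  closure-small-below : {𝓘 : PSet {P} {Q}} → IsDownSet 𝓘 →
    ∀ f g → Closure 𝓘 f → Small g → g ⊑ f → 𝓘 g
  closure-small-below isDown f g cl small g⊑f =
    let (f′ , (g⊑f′ , _) , i) = cl g ⊤ᵖ small ⊤ᵖ-large (g⊑f , λ _ _ _ → tt)
    in isDown g f′ g⊑f′ i

  closure-large-above : {𝓕 : PSet {P} {Q}} → IsUpSet 𝓕 →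
    ∀ f h → Closure 𝓕 f → Large h → f ⊑ h → 𝓕 h
  closure-large-above isUp f h cl large f⊑h =
    let (f′ , (_ , f′⊑h) , i) = cl ⊥ᵖ h ⊥ᵖ-small large ((λ _ _ ()) , f⊑h)
    in isUp f′ h f′⊑h i

module NaturalProfunctors (em₀ : ExcludedMiddle 0ℓ)
  {P Q : Poset₀} (natP : IsNatural P) (natQ : IsNatural Q) where
  open Profunctors {P} {Q}
  private
    module P = Poset P
    module Q = Poset Q
    module FP = FiniteSets em₀ P
    module FQ = FiniteSets em₀ Q
    module NP = FP.Natural natP
    module NQ = FQ.Natural natQ
    dne : {A : Set} → ¬ ¬ A → A
    dne = FP.dne

  colim-compact : (fs : ℕ → Pro P Q) → Increasing fs → (g : Pro P Q) → Small g → g ⊑ colim fs →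
    ∃ λ n → g ⊑ fs n
  colim-compact fs inc g small g⊑ =
    let (n , below) = FQ.finite-eventually small ascending-in-q respects-≈ column
    in n , λ p q a → below q (p , a) p a
    where
      ascending-in-q : Ascending λ n q → ∀ p → app g p q → app (fs n) p q
      ascending-in-q = ascending λ n t p a → inc n p _ (t p a)

      respects-≈ : ∀ {n} → (λ q → ∀ p → app g p q → app (fs n) p q) Respects Q._≈_
      respects-≈ {n} q≈q′ t p a =
        down (fs n) (Q.reflexive (Q.Eq.sym q≈q′)) (t p (down g (Q.reflexive q≈q′) a))

      column : ∀ q → (∃ λ p → app g p q) → ∃ λ n → ∀ p → app g p q → app (fs n) p q
      column q _ =
        NP.upset-eventually (mono g) (ascending λ n {p} → inc n p q) (mono (fs _)) (λ p a → g⊑ p q a)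

  lim-compact : (fs : ℕ → Pro P Q) → Decreasing fs → (h : Pro P Q) → Large h → lim fs ⊑ h →
    ∃ λ n → fs n ⊑ h
  lim-compact fs dec h large lim⊑h =
    let (n , above) = FP.finite-eventually large ascending-in-p respects-≈ row
    in n , λ p q a → dne λ ¬hpq → ¬hpq (above p (λ full → ¬hpq (full q)) q a)
    where
      ascending-in-p : Ascending λ n p → ∀ q → app (fs n) p q → app h p q
      ascending-in-p = ascending λ n t q a → t q (dec n _ q a)

      respects-≈ : ∀ {n} → (λ p → ∀ q → app (fs n) p q → app h p q) Respects P._≈_
      respects-≈ {n} p≈p′ t q a =
        mono h (P.reflexive p≈p′) (t q (mono (fs n) (P.reflexive (P.Eq.sym p≈p′)) a))

      -- the complements of h p and of the fs n p are up-sets of Q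
      row : ∀ p → ¬ (∀ q → app h p q) → ∃ λ n → ∀ q → app (fs n) p q → app h p q
      row p _ =
        let (n , outside) = NQ.upset-eventually (λ q≤q′ ¬a a′ → ¬a (down h q≤q′ a′))
              (ascending λ n {q} ¬a a′ → ¬a (dec n p q a′))
              (λ {n} q≤q′ ¬a a′ → ¬a (down (fs n) q≤q′ a′))
              (λ q ¬hpq → dne λ ¬∃ → ¬hpq (lim⊑h p q (λ i → dne λ ¬a → ¬∃ (i , ¬a))))
        in n , λ q a → dne λ ¬hpq → outside q ¬hpq a

  truncate : Pro P Q → ℕ → Pro P Q
  app (truncate f n) p q = app f p q × NQ.layer n q
  down (truncate f n) q′≤q (a , l) = down f q′≤q a , NQ.layer-down-closed n q′≤q l
  mono (truncate f n) p≤p′ (a , l) = mono f p≤p′ a , l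

  truncate-increasing : ∀ f → Increasing (truncate f)
  truncate-increasing f n p q (a , l) = a , inj₁ l

  truncate-small : ∀ f n → Small (truncate f n)
  truncate-small f n = let (qs , cover) = NQ.layer-finite n in qs , λ q (p , a , l) → cover q l

  truncate-⊑ : ∀ f n → truncate f n ⊑ f
  truncate-⊑ f n p q = proj₁

  ⊑-colim-truncate : ∀ f → f ⊑ colim (truncate f)
  ⊑-colim-truncate f p q a = let (n , l) = NQ.layer-exhaustive q in n , a , l

  cotruncate : Pro P Q → ℕ → Pro P Q
  app (cotruncate f n) p q = app f p q ⊎ ¬ NP.layer n p
  down (cotruncate f n) q′≤q = [ (λ a → inj₁ (down f q′≤q a)) , inj₂ ]
  mono (cotruncate f n) p≤p′ =
    [ (λ a → inj₁ (mono f p≤p′ a)) , (λ ¬l → inj₂ (λ l′ → ¬l (NP.layer-down-closed n p≤p′ l′))) ]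

  cotruncate-decreasing : ∀ f → Decreasing (cotruncate f)
  cotruncate-decreasing f n p q = [ inj₁ , (λ ¬l → inj₂ (λ l → ¬l (inj₁ l))) ]

  cotruncate-large : ∀ f n → Large (cotruncate f n)
  cotruncate-large f n = FP.finite-⊆ (λ p ¬full → dne λ ¬l → ¬full (λ q → inj₂ ¬l)) (NP.layer-finite n)

  ⊑-cotruncate : ∀ f n → f ⊑ cotruncate f n
  ⊑-cotruncate f n p q = inj₁

  lim-cotruncate-⊑ : ∀ f → lim (cotruncate f) ⊑ f
  lim-cotruncate-⊑ f p q a =
    let (n , l) = NP.layer-exhaustive p in [ (λ fpq → fpq) , (λ ¬l → ⊥-elim (¬l l)) ] (a n)

module Characterisation (em₀ : ExcludedMiddle 0ℓ) (em₁ : ExcludedMiddle (lsuc 0ℓ))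
  {P Q : Poset₀} (natP : IsNatural P) (natQ : IsNatural Q) where
  open Profunctors {P} {Q}
  open Topology em₁ {P} {Q}
  open NaturalProfunctors em₀ natP natQ

  below-colim-in-closure : {𝓘 : PSet {P} {Q}} → IsDownSet 𝓘 → (fs : ℕ → Pro P Q) → Increasing fs →
    (∀ n → 𝓘 (fs n)) → ∀ f → f ⊑ colim fs → Closure 𝓘 f
  below-colim-in-closure isDown fs inc ins f f⊑ g h small large (g⊑f , f⊑h) =
    let (n , g⊑fs) = colim-compact fs inc g small (λ p q a → f⊑ p q (g⊑f p q a))
    in fs n ⊓ᵖ h , ((λ p q a → g⊑fs p q a , f⊑h p q (g⊑f p q a)) , (λ p q → proj₂))
       , isDown (fs n ⊓ᵖ h) (fs n) (λ p q → proj₁) (ins n)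

  above-lim-in-closure : {𝓕 : PSet {P} {Q}} → IsUpSet 𝓕 → (fs : ℕ → Pro P Q) → Decreasing fs →
    (∀ n → 𝓕 (fs n)) → ∀ f → lim fs ⊑ f → Closure 𝓕 f
  above-lim-in-closure isUp fs dec ins f ⊑f g h small large (g⊑f , f⊑h) =
    let (n , fs⊑h) = lim-compact fs dec h large (λ p q a → f⊑h p q (⊑f p q a))
    in fs n ⊔ᵖ g , ((λ p q → inj₂) , (λ p q → [ fs⊑h p q , (λ a → f⊑h p q (g⊑f p q a)) ]))
       , isUp (fs n) (fs n ⊔ᵖ g) (λ p q → inj₁) (ins n)

  ColimClosed LargeColimClosed LimClosed SmallLimClosed : PSet {P} {Q} → Set₁
  ColimClosed 𝓘 = ∀ fs → Increasing fs → (∀ n → 𝓘 (fs n)) → 𝓘 (colim fs)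
  LargeColimClosed 𝓘 = ∀ fs → Increasing fs → (∀ n → 𝓘 (fs n)) → Large (colim fs) → 𝓘 (colim fs)
  LimClosed 𝓕 = ∀ fs → Decreasing fs → (∀ n → 𝓕 (fs n)) → 𝓕 (lim fs)
  SmallLimClosed 𝓕 = ∀ fs → Decreasing fs → (∀ n → 𝓕 (fs n)) → Small (lim fs) → 𝓕 (lim fs)

  module DownSets {𝓘 : PSet {P} {Q}} (isDown : IsDownSet 𝓘) where
    truncations-in : ∀ f → Closure 𝓘 f → ∀ n → 𝓘 (truncate f n)
    truncations-in f cl n =
      closure-small-below isDown f (truncate f n) cl (truncate-small f n) (truncate-⊑ f n)

    closure⊆⇔colim-closed : (∀ f → Closure 𝓘 f → 𝓘 f) ⇔ ColimClosed 𝓘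
    closure⊆⇔colim-closed = mk⇔ to from
      where
        to : (∀ f → Closure 𝓘 f → 𝓘 f) → ColimClosed 𝓘
        to ⊆𝓘 fs inc ins = ⊆𝓘 (colim fs) (below-colim-in-closure isDown fs inc ins (colim fs) (λ _ _ a → a))

        from : ColimClosed 𝓘 → ∀ f → Closure 𝓘 f → 𝓘 f
        from closed f cl = isDown f (colim (truncate f)) (⊑-colim-truncate f)
          (closed (truncate f) (truncate-increasing f) (truncations-in f cl))

    interior-closure⊆⇔large-colim-closed : (∀ f → Interior (Closure 𝓘) f → 𝓘 f) ⇔ LargeColimClosed 𝓘
    interior-closure⊆⇔large-colim-closed = mk⇔ to from
      where
        to : (∀ f → Interior (Closure 𝓘) f → 𝓘 f) → LargeColimClosed 𝓘
        to ⊆𝓘 fs inc ins large = ⊆𝓘 (colim fs)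
          (⊥ᵖ , colim fs , ⊥ᵖ-small , large , ((λ _ _ ()) , (λ _ _ a → a))
          , λ f′ (_ , f′⊑) → below-colim-in-closure isDown fs inc ins f′ f′⊑)

        from : LargeColimClosed 𝓘 → ∀ f → Interior (Closure 𝓘) f → 𝓘 f
        from closed f (g , h , _ , large , (g⊑f , f⊑h) , inside) =
          isDown f (colim (truncate h)) (λ p q a → ⊑-colim-truncate h p q (f⊑h p q a))
            (closed (truncate h) (truncate-increasing h) (truncations-in h h-in-closure)
              (large-mono h (colim (truncate h)) (⊑-colim-truncate h) large))
          where
            h-in-closure : Closure 𝓘 h
            h-in-closure = inside h ((λ p q a → f⊑h p q (g⊑f p q a)) , (λ _ _ a → a))

  module UpSets {𝓕 : PSet {P} {Q}} (isUp : IsUpSet 𝓕) where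
    cotruncations-in : ∀ f → Closure 𝓕 f → ∀ n → 𝓕 (cotruncate f n)
    cotruncations-in f cl n =
      closure-large-above isUp f (cotruncate f n) cl (cotruncate-large f n) (⊑-cotruncate f n)

    closure⊆⇔lim-closed : (∀ f → Closure 𝓕 f → 𝓕 f) ⇔ LimClosed 𝓕
    closure⊆⇔lim-closed = mk⇔ to from
      where
        to : (∀ f → Closure 𝓕 f → 𝓕 f) → LimClosed 𝓕
        to ⊆𝓕 fs dec ins = ⊆𝓕 (lim fs) (above-lim-in-closure isUp fs dec ins (lim fs) (λ _ _ a → a))

        from : LimClosed 𝓕 → ∀ f → Closure 𝓕 f → 𝓕 f
        from closed f cl = isUp (lim (cotruncate f)) f (lim-cotruncate-⊑ f)
          (closed (cotruncate f) (cotruncate-decreasing f) (cotruncations-in f cl))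

    interior-closure⊆⇔small-lim-closed : (∀ f → Interior (Closure 𝓕) f → 𝓕 f) ⇔ SmallLimClosed 𝓕
    interior-closure⊆⇔small-lim-closed = mk⇔ to from
      where
        to : (∀ f → Interior (Closure 𝓕) f → 𝓕 f) → SmallLimClosed 𝓕
        to ⊆𝓕 fs dec ins small = ⊆𝓕 (lim fs)
          (lim fs , ⊤ᵖ , small , ⊤ᵖ-large , ((λ _ _ a → a) , (λ _ _ _ → tt))
          , λ f′ (⊑f′ , _) → above-lim-in-closure isUp fs dec ins f′ ⊑f′)

        from : SmallLimClosed 𝓕 → ∀ f → Interior (Closure 𝓕) f → 𝓕 f
        from closed f (g , h , small , _ , (g⊑f , f⊑h) , inside) =
          isUp (lim (cotruncate g)) f (λ p q a → g⊑f p q (lim-cotruncate-⊑ g p q a))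
            (closed (cotruncate g) (cotruncate-decreasing g) (cotruncations-in g g-in-closure)
              (small-antimono (lim (cotruncate g)) g (lim-cotruncate-⊑ g) small))
          where
            g-in-closure : Closure 𝓕 g
            g-in-closure = inside g ((λ _ _ a → a) , (λ p q a → f⊑h p q (g⊑f p q a)))

proposition6p6 : ExcludedMiddle 0ℓ → ExcludedMiddle (lsuc 0ℓ) →
    (P Q : Poset₀) → IsNatural P → IsNatural Q →
    (∀ (𝓘 : PSet {P} {Q}) → IsOpen 𝓘 → IsDownSet 𝓘 →
      (IsClosed 𝓘 ⇔ (∀ fs → Increasing fs → (∀ n → 𝓘 (fs n)) → 𝓘 (colim fs)))
      × (IsRegular 𝓘 ⇔
          (∀ fs → Increasing fs → (∀ n → 𝓘 (fs n)) → Large (colim fs) → 𝓘 (colim fs))))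
    × (∀ (𝓕 : PSet {P} {Q}) → IsOpen 𝓕 → IsUpSet 𝓕 →
      (IsClosed 𝓕 ⇔ (∀ fs → Decreasing fs → (∀ n → 𝓕 (fs n)) → 𝓕 (lim fs)))
      × (IsRegular 𝓕 ⇔
          (∀ fs → Decreasing fs → (∀ n → 𝓕 (fs n)) → Small (lim fs) → 𝓕 (lim fs))))
proposition6p6 em₀ em₁ P Q natP natQ =
  (λ 𝓘 isOpen isDown → let open DownSets isDown in
      closure⊆⇔colim-closed ⇔-∘ closed⇔closure⊆ 𝓘
    , interior-closure⊆⇔large-colim-closed ⇔-∘ regular⇔interior-closure⊆ 𝓘 isOpen)
  , (λ 𝓕 isOpen isUp → let open UpSets isUp in
      closure⊆⇔lim-closed ⇔-∘ closed⇔closure⊆ 𝓕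
    , interior-closure⊆⇔small-lim-closed ⇔-∘ regular⇔interior-closure⊆ 𝓕 isOpen)
  where
    open Topology em₁ {P} {Q}
    open Characterisation em₀ em₁ natP natQ
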